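{- Let $k\ge 2$ and let $T$ be a $k$-triangulation of a convex $n$-gon containing the diagonal $(a,b)$, where $a\le b-k-1$. Then there exists $i\in\{a,\dots,b-k-1\}$ such that $T$ contains the diagonal $(i,i+k+1)$.
   Context: The vertices of the convex $n$-gon are labeled $1,\dots,n$ clockwise; $(a,b)$ with $a<b$ denotes the diagonal joining $a$ and $b$. Two diagonals cross if they intersect in their interiors (for $a<c$, $(a,b)$ and $(c,d)$ cross iff $a<c<b<d$). A $(k+1)$-crossing is a set of $k+1$ pairwise crossing diagonals; a $k$-triangulation is a maximal set of diagonals containing no $(k+1)$-crossing. -}

module Defs where

open import Data.Nat using (ℕ; suc; _+_; _≤_; _<_)
open import Data.Bool using (Bool; true; false)
open import Data.Fin using (Fin)
open import Data.Product using (Σ; _×_; _,_)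
open import Data.Sum using (_⊎_)
open import Data.Empty using (⊥)
open import Relation.Binary.PropositionalEquality using (_≡_; _≢_)

-- Vertices of the convex n-gon are 1,…,n (clockwise).
-- (a , b) with 1 ≤ a < b ≤ n is the diagonal joining a and b
-- (every pair of vertices, as in the paper's convention).
IsDiagonal : ℕ → ℕ → ℕ → Set
IsDiagonal n a b = 1 ≤ a × a < b × b ≤ n

Cross : ℕ → ℕ → ℕ → ℕ → Set
Cross a b c d = (a < c × c < b × b < d) ⊎ (c < a × a < d × d < b)

DiagSet : Set
DiagSet = ℕ → ℕ → Bool

_∈D_ : ℕ × ℕ → DiagSet → Set
(a , b) ∈D T = T a b ≡ true

HasCrossing : ℕ → (ℕ → ℕ → Set) → Set
HasCrossing m P =
  Σ (Fin m → ℕ) λ s → Σ (Fin m → ℕ) λ t →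
    ((i : Fin m) → P (s i) (t i)) ×
    ((i j : Fin m) → i ≢ j → Cross (s i) (t i) (s j) (t j))

record IsKTriangulation (n k : ℕ) (T : DiagSet) : Set where
  field
    subset    : ∀ a b → T a b ≡ true → IsDiagonal n a b
    noCross   : HasCrossing (suc k) (λ a b → T a b ≡ true) → ⊥
    maximal   : ∀ a b → IsDiagonal n a b → T a b ≡ false →
                HasCrossing (suc k) (λ c d → T c d ≡ true ⊎ (c ≡ a × d ≡ b))

{-# OPTIONS --safe #-}
-- Shrink a diagonal (a,b) ∈ T with b ≥ a+k+1 until it has length exactly k+1.
-- If (a,b-1) ∈ T, pass to it. Otherwise, by maximality, T contains k pairwise
-- crossing diagonals that all cross (a,b-1). They cannot all cross (a,b) too,
-- since T has no (k+1)-crossing; one that crosses (a,b-1) but not (a,b) is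
-- (f,b) with a < f. As a member of a (k+1)-crossing, (f,b) has length at least
-- k+1: the other k members have pairwise distinct endpoints strictly inside it.
-- So we pass to (f,b).
module Submission where

open import Defs
open import Data.Nat using (ℕ; suc; zero; _+_; _∸_; _≤_; _<_; _<?_; s≤s; s≤s⁻¹; z<s)
open import Data.Nat.Properties
open import Data.Bool using (true; false)
open import Data.Bool.Properties using () renaming (_≟_ to _≟ᵇ_)
open import Data.Fin using (Fin; zero; suc; toℕ; fromℕ<; punchIn) renaming (_≟_ to _≟ᶠ_)
open import Data.Fin.Properties using (toℕ-fromℕ<; injective⇒≤; ¬∀⟶∃¬; all?; punchIn-injective; punchInᵢ≢i)
open import Data.Vec.Functional using (_∷_)
open import Data.Product using (Σ; _×_; _,_; proj₁; proj₂)
open import Data.Sum using (_⊎_; inj₁; inj₂)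
open import Function using (_∘_)
open import Relation.Nullary using (¬_; Dec; yes; no; contradiction)
open import Relation.Nullary.Decidable using (_×-dec_; _⊎-dec_)
open import Relation.Binary.PropositionalEquality using (_≡_; _≢_; refl; sym; trans; cong; subst; subst₂; ≢-sym)

variable
  a b c d x y m : ℕ

Cross-sym : Cross a b c d → Cross c d a b
Cross-sym (inj₁ ordered) = inj₂ ordered
Cross-sym (inj₂ ordered) = inj₁ ordered

Cross-irrefl : ¬ Cross a b a b
Cross-irrefl (inj₁ (a<a , _)) = <-irrefl refl a<a
Cross-irrefl (inj₂ (a<a , _)) = <-irrefl refl a<a

cross? : ∀ a b c d → Dec (Cross a b c d)
cross? a b c d = (a <? c ×-dec c <? b ×-dec b <? d) ⊎-dec (c <? a ×-dec a <? d ×-dec d <? b)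

Cross⇒< : Cross a b c d → c < d
Cross⇒< (inj₁ (_ , c<b , b<d)) = <-trans c<b b<d
Cross⇒< (inj₂ (c<a , a<d , _)) = <-trans c<a a<d

Cross-lost-by-extension : Cross a b x y → ¬ Cross a (suc b) x y → a < x × y ≡ suc b
Cross-lost-by-extension (inj₁ (a<x , x<b , b<y)) ¬cross =
  a<x , ≤-antisym (≮⇒≥ λ b+1<y → ¬cross (inj₁ (a<x , m<n⇒m<1+n x<b , b+1<y))) b<y
Cross-lost-by-extension (inj₂ (x<a , a<y , y<b)) ¬cross =
  contradiction (inj₂ (x<a , a<y , m<n⇒m<1+n y<b)) ¬cross

Endpoint : ℕ → ℕ → ℕ → Set
Endpoint x a b = x ≡ a ⊎ x ≡ b

Cross⇒endpoint-between : Cross a b c d → Σ ℕ λ x → Endpoint x c d × a < x × x < b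
Cross⇒endpoint-between (inj₁ (a<c , c<b , _)) = _ , inj₁ refl , a<c , c<b
Cross⇒endpoint-between (inj₂ (_ , a<d , d<b)) = _ , inj₂ refl , a<d , d<b

ordered-endpoints-distinct : a < c → c < b → b < d → Endpoint x a b → Endpoint y c d → x ≢ y
ordered-endpoints-distinct a<c c<b b<d (inj₁ refl) (inj₁ refl) = <⇒≢ a<c
ordered-endpoints-distinct a<c c<b b<d (inj₁ refl) (inj₂ refl) = <⇒≢ (<-trans a<c (<-trans c<b b<d))
ordered-endpoints-distinct a<c c<b b<d (inj₂ refl) (inj₁ refl) = >⇒≢ c<b
ordered-endpoints-distinct a<c c<b b<d (inj₂ refl) (inj₂ refl) = <⇒≢ b<d

Cross⇒endpoints-distinct : Cross a b c d → Endpoint x a b → Endpoint y c d → x ≢ y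
Cross⇒endpoints-distinct (inj₁ (a<c , c<b , b<d)) = ordered-endpoints-distinct a<c c<b b<d
Cross⇒endpoints-distinct (inj₂ (c<a , a<d , d<b)) x∈ab y∈cd =
  ≢-sym (ordered-endpoints-distinct c<a a<d d<b y∈cd x∈ab)

m<m+n+1 : ∀ m n → m < m + n + 1
m<m+n+1 m n = ≤-<-trans (m≤m+n m n) (m<m+n (m + n) z<s)

PairwiseCross : (Fin m → ℕ) → (Fin m → ℕ) → Set
PairwiseCross s t = ∀ i j → i ≢ j → Cross (s i) (t i) (s j) (t j)

crossing-member-length : {s t : Fin m → ℕ} → PairwiseCross s t →
                         ∀ i → s i < t i → s i + m ≤ t i
crossing-member-length {m} {s} {t} cross i sᵢ<tᵢ = begin
  s i + m            ≤⟨ +-monoʳ-≤ (s i) (injective⇒≤ offset-injective) ⟩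
  s i + (t i ∸ s i)  ≡⟨ m+[n∸m]≡n (<⇒≤ sᵢ<tᵢ) ⟩
  t i                ∎
  where
  open ≤-Reasoning

  point : Fin m → ℕ
  point j with j ≟ᶠ i
  ... | yes _   = s i
  ... | no j≢i = proj₁ (Cross⇒endpoint-between (cross i j (≢-sym j≢i)))

  point-spec : ∀ j → Endpoint (point j) (s j) (t j) × s i ≤ point j × point j < t i
  point-spec j with j ≟ᶠ i
  ... | yes refl = inj₁ refl , ≤-refl , sᵢ<tᵢ
  ... | no j≢i with Cross⇒endpoint-between (cross i j (≢-sym j≢i))
  ...   | _ , endpoint , sᵢ<x , x<tᵢ = endpoint , <⇒≤ sᵢ<x , x<tᵢ

  point-endpoint : ∀ j → Endpoint (point j) (s j) (t j)
  point-endpoint = proj₁ ∘ point-spec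

  sᵢ≤point : ∀ j → s i ≤ point j
  sᵢ≤point = proj₁ ∘ proj₂ ∘ point-spec

  point<tᵢ : ∀ j → point j < t i
  point<tᵢ = proj₂ ∘ proj₂ ∘ point-spec

  offset : Fin m → Fin (t i ∸ s i)
  offset j = fromℕ< (∸-monoˡ-< (point<tᵢ j) (sᵢ≤point j))

  offset-injective : ∀ {j j′} → offset j ≡ offset j′ → j ≡ j′
  offset-injective {j} {j′} same-offset with j ≟ᶠ j′
  ... | yes j≡j′ = j≡j′
  ... | no j≢j′ = contradiction same-point
        (Cross⇒endpoints-distinct (cross j j′ j≢j′) (point-endpoint j) (point-endpoint j′))
    where
    same-point : point j ≡ point j′
    same-point = ∸-cancelʳ-≡ (sᵢ≤point j) (sᵢ≤point j′)
      (trans (sym (toℕ-fromℕ< _)) (trans (cong toℕ same-offset) (toℕ-fromℕ< _)))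

cons-pairwiseCross : {s t : Fin m → ℕ} → PairwiseCross s t →
                     (∀ j → Cross a b (s j) (t j)) → PairwiseCross (a ∷ s) (b ∷ t)
cons-pairwiseCross cross new zero    zero    0≢0 = contradiction refl 0≢0
cons-pairwiseCross cross new zero    (suc j) _   = new j
cons-pairwiseCross cross new (suc i) zero    _   = Cross-sym (new i)
cons-pairwiseCross cross new (suc i) (suc j) i≢j = cross i j (i≢j ∘ cong suc)

extend-crossing : {P : ℕ → ℕ → Set} → HasCrossing m (λ x y → P x y × Cross a b x y) →
                  P a b → HasCrossing (suc m) P
extend-crossing {a = a} {b} {P} (s , t , partner , cross) a,b∈P =
  a ∷ s , b ∷ t , member , cons-pairwiseCross cross (proj₂ ∘ partner)
  where
  member : ∀ i → P ((a ∷ s) i) ((b ∷ t) i)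
  member zero    = a,b∈P
  member (suc j) = proj₁ (partner j)

new-crossing-partners : {P : ℕ → ℕ → Set} → (∀ x y → Dec (P x y)) → ¬ HasCrossing (suc m) P →
                        HasCrossing (suc m) (λ x y → P x y ⊎ (x ≡ a × y ≡ b)) →
                        HasCrossing m (λ x y → P x y × Cross a b x y)
new-crossing-partners {m} {P = P} P? no-crossing (s , t , member , cross)
  with ¬∀⟶∃¬ (suc m) _ (λ i → P? (s i) (t i)) (λ all∈P → no-crossing (s , t , all∈P , cross))
... | i , i∉P with member i
...   | inj₁ i∈P = contradiction i∈P i∉P
...   | inj₂ (refl , refl) =
  s ∘ punchIn i , t ∘ punchIn i , partner , λ j j′ j≢j′ → cross _ _ (j≢j′ ∘ punchIn-injective i j j′)
  where
  partner : ∀ j → P (s (punchIn i j)) (t (punchIn i j)) × Cross (s i) (t i) (s (punchIn i j)) (t (punchIn i j))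
  partner j with member (punchIn i j) | cross i (punchIn i j) (≢-sym (punchInᵢ≢i i j))
  ... | inj₁ j∈P         | crosses = j∈P , crosses
  ... | inj₂ (s≡ , t≡) | crosses = contradiction (subst₂ (Cross (s i) (t i)) s≡ t≡ crosses) Cross-irrefl

module _ {n k : ℕ} {T : DiagSet} (tri : IsKTriangulation n k T) where
  open IsKTriangulation tri

  ShortDiagonalWithin : ℕ → ℕ → Set
  ShortDiagonalWithin a b = Σ ℕ λ i → (a ≤ i × i + k + 1 ≤ b) × T i (i + k + 1) ≡ true

  ShortDiagonalWithin-mono : a ≤ c → d ≤ b → ShortDiagonalWithin c d → ShortDiagonalWithin a b
  ShortDiagonalWithin-mono a≤c d≤b (i , (c≤i , i+k+1≤d) , short) =
    i , (≤-trans a≤c c≤i , ≤-trans i+k+1≤d d≤b) , short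

  shrink-left : c < d → T c (suc d) ≡ true → T c d ≡ false →
                Σ ℕ λ f → c < f × T f (suc d) ≡ true × f + k + 1 ≤ suc d
  shrink-left {c} {d} c<d c,d+1∈T c,d∉T
    with subset c (suc d) c,d+1∈T
  ... | 1≤c , _ , d+1≤n
    with new-crossing-partners (λ x y → T x y ≟ᵇ true) noCross
           (maximal c d (1≤c , c<d , ≤-trans (n≤1+n d) d+1≤n) c,d∉T)
  ... | s , t , partner , cross
    with all? (λ j → cross? c (suc d) (s j) (t j))
  ... | yes all-cross =
    contradiction (extend-crossing {P = λ x y → T x y ≡ true}
                     (s , t , (λ j → proj₁ (partner j) , all-cross j) , cross) c,d+1∈T)
                  noCross
  ... | no ¬all-cross
    with ¬∀⟶∃¬ k _ (λ j → cross? c (suc d) (s j) (t j)) ¬all-cross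
  ... | j , ¬crosses
    with Cross-lost-by-extension (proj₂ (partner j)) ¬crosses
  ... | c<sⱼ , tⱼ≡d+1 =
    s j , c<sⱼ , subst (λ y → T (s j) y ≡ true) tⱼ≡d+1 (proj₁ (partner j)) ,
    subst₂ _≤_ (trans (+-suc (s j) k) (+-comm 1 (s j + k))) tⱼ≡d+1
      (crossing-member-length (cons-pairwiseCross cross (proj₂ ∘ partner)) (suc j)
        (Cross⇒< (proj₂ (partner j))))

  short-diagonal-within : ∀ L → T c d ≡ true → c + k + 1 ≤ d → d ≤ L + c → ShortDiagonalWithin c d
  short-diagonal-within {c} zero _ c+k+1≤d d≤c = contradiction (≤-trans c+k+1≤d d≤c) (<⇒≱ (m<m+n+1 c k))
  short-diagonal-within {c} (suc L) c,d∈T c+k+1≤d _ with m≤n⇒m<n∨m≡n c+k+1≤d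
  ... | inj₂ refl = c , (≤-refl , ≤-refl) , c,d∈T
  short-diagonal-within {c} {suc d} (suc L) c,d+1∈T _ d<L+c | inj₁ (s≤s c+k+1≤d) with T c d in T[c,d]
  ... | true = ShortDiagonalWithin-mono ≤-refl (n≤1+n d)
                 (short-diagonal-within L T[c,d] c+k+1≤d (s≤s⁻¹ d<L+c))
  ... | false with shrink-left (<-≤-trans (m<m+n+1 c k) c+k+1≤d) c,d+1∈T T[c,d]
  ...   | f , c<f , f,d+1∈T , f+k+1≤d+1 = ShortDiagonalWithin-mono (<⇒≤ c<f) ≤-refl
            (short-diagonal-within L f,d+1∈T f+k+1≤d+1
              (≤-trans d<L+c (≤-trans (≤-reflexive (sym (+-suc L c))) (+-monoʳ-≤ L c<f))))

lemma6p2 : (n k : ℕ) → 2 ≤ k → (T : DiagSet) → IsKTriangulation n k T →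
    (a b : ℕ) → T a b ≡ true → a + k + 1 ≤ b →
    Σ ℕ λ i → (a ≤ i × i + k + 1 ≤ b) × T i (i + k + 1) ≡ true
lemma6p2 n k _ T tri a b a,b∈T a+k+1≤b = short-diagonal-within tri b a,b∈T a+k+1≤b (m≤m+n b a)
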